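{- Let $\Sigma$ be a finite alphabet, $w$ a positive integer, $\tau=(R_1,\dots,R_m)$ a relational vocabulary and $n$ a nonnegative integer. The relation $$\mathcal{R}(\Sigma,w,\tau,n)=\{(D_0,D_1,\dots,D_m,v_1,\dots,v_n): (D_0,\dots,D_m)\in\mathcal{R}(\Sigma,w,\tau),\ v_1,\dots,v_n\in L(D_0)\}$$ is regular.
   Context: Fix a padding symbol $\#$ not in any alphabet. For an alphabet $\Gamma$, $\Gamma^{\otimes a}$ is $\Gamma^a$ regarded as an alphabet. For nonempty strings $u_1,\dots,u_a$, $u_1\otimes\cdots\otimes u_a$ is the string of length $\max_i|u_i|$ whose $j$-th symbol is the tuple of $j$-th symbols of the $u_i$, with $\#$ in place of missing symbols; $L^{\otimes a}=\{u_1\otimes\cdots\otimes u_a:u_i\in L\}$. A relation $R$ of tuples of nonempty strings (possibly over different alphabets in different coordinates) is regular if $\{u_1\otimes\cdots\otimes u_a:(u_1,\dots,u_a)\in R\}$ is accepted by a finite automaton. ODDs. For an alphabet $\Gamma$ and $w\ge1$, a $(\Gamma,w)$-layer is $B=(\ell,r,T,I,F,\iota,\phi)$ with $\ell,r\subseteq\{0,\dots,w-1\}$, $T\subseteq\ell\times(\Gamma\sqcup\{\#\})\times r$, $I\subseteq\ell$, $F\subseteq r$, Booleans $\iota,\phi$, $I=\emptyset$ if $\iota$ is false and $F=\emptyset$ if $\phi$ is false; $\mathcal{B}(\Gamma,w)$ is the set of such layers. A $(\Gamma,w)$-ODD of length $k$ is a string $B_1\cdots B_k$ over $\mathcal{B}(\Gamma,w)$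 with $\ell(B_{i+1})=r(B_i)$, $\iota(B_i)$ true iff $i=1$, $\phi(B_i)$ true iff $i=k$; $\mathcal{B}(\Gamma,w,k)$ is the set of them. A nonempty string $\sigma_1\cdots\sigma_{k'}$ over $\Gamma$, $k'\le k$, is accepted if, padding with $\#$ to length $k$ (symbols $\hat\sigma_i$), there are $(p_i,\hat\sigma_i,q_i)\in T(B_i)$ with $p_{i+1}=q_i$, $p_1\in I(B_1)$, $q_k\in F(B_k)$; $L(D)$ is the set of accepted strings. Structural tuples. $\tau=(R_1,\dots,R_m)$ has arities $a_i$. A tuple $(D_0,\dots,D_m)$ is $(\Sigma,w,\tau)$-structural if there is $k\ge1$ with $D_0\in\mathcal{B}(\Sigma,w,k)$, $D_i\in\mathcal{B}(\Sigma^{\otimes a_i},w,k)$ and $L(D_i)\subseteq L(D_0)^{\otimes a_i}$ for all $i\in[m]$. $\mathcal{R}(\Sigma,w,\tau)$ is the set of all $(\Sigma,w,\tau)$-structural tuples. -}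

module Defs where

open import Data.Nat using (ℕ; zero; suc; _^_; _≤_; _<_; _∸_)
open import Data.Fin using (Fin; zero; suc; remQuot)
open import Data.Bool using (Bool; true; false; T; _∧_; _∨_; not)
open import Data.Maybe using (Maybe; just; nothing)
open import Data.List using (List; []; _∷_; _++_; map; length; replicate)
open import Data.Vec using (Vec; lookup) renaming ([] to []ᵛ; _∷_ to _∷ᵛ_)
open import Data.Product using (Σ; ∃; _×_; _,_; proj₁; proj₂)
open import Data.Unit using (⊤; tt)
open import Data.Empty using (⊥)
open import Function.Bundles using (_⇔_)
open import Relation.Binary.PropositionalEquality using (_≡_)

-- Convention: a finite alphabet of size g is Fin g.  The padding symbol
-- # is represented by 'nothing' in 'Maybe'.

allF : (n : ℕ) → (Fin n → Bool) → Bool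
allF zero    f = true
allF (suc n) f = f zero ∧ allF n (λ i → f (suc i))

code : {g : ℕ} → Maybe (Fin g) → Fin (suc g)
code nothing  = zero
code (just i) = suc i

-- (Γ,w)-layers, Γ = Fin g.  Subsets of {0,…,w-1} are Vec Bool w;
-- T ⊆ {0..w-1} × (Γ ⊔ {#}) × {0..w-1} is stored as a Boolean table
-- Tr[p][code c][q].

layerOK : (g w : ℕ) → (ℓ r : Vec Bool w) → Vec (Vec (Vec Bool w) (suc g)) w →
          (I F : Vec Bool w) → (ι φ : Bool) → Bool
layerOK g w ℓ r Tr I F ι φ =
  allF w (λ p → allF (suc g) (λ c → allF w (λ q →
      not (lookup (lookup (lookup Tr p) c) q) ∨ (lookup ℓ p ∧ lookup r q))))
  ∧ allF w (λ p → not (lookup I p) ∨ (ι ∧ lookup ℓ p))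
  ∧ allF w (λ q → not (lookup F q) ∨ (φ ∧ lookup r q))

record Layer (g w : ℕ) : Set where
  constructor layer
  field
    ℓ  : Vec Bool w
    r  : Vec Bool w
    Tr : Vec (Vec (Vec Bool w) (suc g)) w
    I  : Vec Bool w
    F  : Vec Bool w
    ι  : Bool
    φ  : Bool
    wf : T (layerOK g w ℓ r Tr I F ι φ)
open Layer public

InT : {g w : ℕ} → Layer g w → Fin w → Maybe (Fin g) → Fin w → Set
InT B p c q = lookup (lookup (lookup (Tr B) p) (code c)) q ≡ true

Chain : {g w : ℕ} → Layer g w → List (Layer g w) → Set
Chain B []        = φ B ≡ true
Chain B (B′ ∷ Bs) = φ B ≡ false × ι B′ ≡ false × ℓ B′ ≡ r B × Chain B′ Bs

IsODD : {g w : ℕ} → List (Layer g w) → Set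
IsODD []       = ⊥
IsODD (B ∷ Bs) = ι B ≡ true × Chain B Bs

Path : {g w : ℕ} → List (Layer g w) → List (Maybe (Fin g)) → Fin w → Set
Path []             _        _ = ⊥
Path (B ∷ [])       []       _ = ⊥
Path (B ∷ [])       (c ∷ []) p = ∃ λ q → InT B p c q × lookup (F B) q ≡ true
Path (B ∷ [])       (c ∷ _ ∷ _) _ = ⊥
Path (B ∷ B′ ∷ Bs)  []       _ = ⊥
Path (B ∷ B′ ∷ Bs)  (c ∷ cs) p = ∃ λ q → InT B p c q × Path (B′ ∷ Bs) cs q

pad : {g : ℕ} → ℕ → List (Fin g) → List (Maybe (Fin g))
pad k σ = map just σ ++ replicate (k ∸ length σ) nothing

InL : {g w : ℕ} → List (Layer g w) → List (Fin g) → Set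
InL []       σ = ⊥
InL (B ∷ Bs) σ = 0 < length σ × length σ ≤ length (B ∷ Bs)
               × ∃ λ p → lookup (I B) p ≡ true × Path (B ∷ Bs) (pad (length (B ∷ Bs)) σ) p

-- Σ^{⊗a}.  Its symbols are a-tuples over Σ ⊔ {#} (needed since u₁⊗⋯⊗uₐ
-- pads with #).  For Σ = Fin s it is the alphabet Fin ((suc s) ^ a),
-- decoded bijectively into tuples by 'untuple'.

tensorSize : ℕ → ℕ → ℕ
tensorSize s a = suc s ^ a

decodeSym : {s : ℕ} → Fin (suc s) → Maybe (Fin s)
decodeSym zero    = nothing
decodeSym (suc i) = just i

untuple : {s : ℕ} (a : ℕ) → Fin (tensorSize s a) → Vec (Maybe (Fin s)) a
untuple zero    _ = []ᵛ
untuple {s} (suc a) i with remQuot {suc s} (tensorSize s a) i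
... | (c , j) = decodeSym c ∷ᵛ untuple a j

allHash : {A : Set} (a : ℕ) → Vec (Maybe A) a
allHash zero    = []ᵛ
allHash (suc a) = nothing ∷ᵛ allHash a

padCons : {A : Set} {a : ℕ} → List A → List (Vec (Maybe A) a) → List (Vec (Maybe A) (suc a))
padCons {a = a} []      []       = []
padCons {a = a} (x ∷ u) []       = (just x ∷ᵛ allHash a) ∷ padCons u []
padCons         []      (c ∷ cs) = (nothing ∷ᵛ c) ∷ padCons [] cs
padCons         (x ∷ u) (c ∷ cs) = (just x ∷ᵛ c) ∷ padCons u cs

tensor : {A : Set} {a : ℕ} → Vec (List A) a → List (Vec (Maybe A) a)
tensor []ᵛ       = []
tensor (u ∷ᵛ us) = padCons u (tensor us)

AllVec : {A : Set} {a : ℕ} → (A → Set) → Vec A a → Set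
AllVec P []ᵛ       = ⊤
AllVec P (x ∷ᵛ xs) = P x × AllVec P xs

InTensorL : {s w : ℕ} (a : ℕ) → List (Layer s w) → List (Fin (tensorSize s a)) → Set
InTensorL {s} a D₀ x =
  ∃ λ (us : Vec (List (Fin s)) a) → AllVec (InL D₀) us × tensor us ≡ map (untuple a) x

Strs : List Set → Set
Strs []       = ⊤
Strs (A ∷ As) = List A × Strs As

Col : List Set → Set
Col []       = ⊤
Col (A ∷ As) = Maybe A × Col As

hashCol : (As : List Set) → Col As
hashCol []       = tt
hashCol (A ∷ As) = nothing , hashCol As

padConsH : {A : Set} (As : List Set) → List A → List (Col As) → List (Col (A ∷ As))
padConsH As []      []       = []
padConsH As (x ∷ u) []       = (just x , hashCol As) ∷ padConsH As u []
padConsH As []      (c ∷ cs) = (nothing , c) ∷ padConsH As [] cs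
padConsH As (x ∷ u) (c ∷ cs) = (just x , c) ∷ padConsH As u cs

conv : (As : List Set) → Strs As → List (Col As)
conv []       _        = []
conv (A ∷ As) (u , us) = padConsH As u (conv As us)

NonEmptyAll : (As : List Set) → Strs As → Set
NonEmptyAll []       _        = ⊤
NonEmptyAll (A ∷ As) (u , us) = 0 < length u × NonEmptyAll As us

record DFA (C : Set) : Set where
  field
    nStates : ℕ
    start   : Fin nStates
    δ       : Fin nStates → C → Fin nStates
    final   : Fin nStates → Bool

run : {C : Set} (M : DFA C) → Fin (DFA.nStates M) → List C → Fin (DFA.nStates M)
run M q []       = q
run M q (c ∷ cs) = run M (DFA.δ M q c) cs

Accepts : {C : Set} → DFA C → List C → Set
Accepts M x = DFA.final M (run M (DFA.start M) x) ≡ true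

Regular : (As : List Set) → (Strs As → Set) → Set
Regular As R = Σ (DFA (Col As)) λ M →
  (x : List (Col As)) → Accepts M x ⇔ (∃ λ t → NonEmptyAll As t × R t × conv As t ≡ x)

-- The relation 𝓡(Σ,w,τ,n), Σ = Fin s, τ given by its list of arities.

splitStrs : (As Bs : List Set) → Strs (As ++ Bs) → Strs As × Strs Bs
splitStrs []       Bs t        = tt , t
splitStrs (A ∷ As) Bs (u , t) with splitStrs As Bs t
... | (x , y) = (u , x) , y

LayerAlphs : ℕ → ℕ → List ℕ → List Set
LayerAlphs s w []      = []
LayerAlphs s w (a ∷ τ) = Layer (tensorSize s a) w ∷ LayerAlphs s w τ

StructRest : {s w : ℕ} → List (Layer s w) → (τ : List ℕ) → Strs (LayerAlphs s w τ) → Set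
StructRest D₀ []      _        = ⊤
StructRest {s} {w} D₀ (a ∷ τ) (D , Ds) =
  IsODD D × length D ≡ length D₀ × (∀ x → InL D x → InTensorL a D₀ x)
  × StructRest D₀ τ Ds

Structural : (s w : ℕ) (τ : List ℕ) → List (Layer s w) → Strs (LayerAlphs s w τ) → Set
Structural s w τ D₀ Ds = IsODD D₀ × StructRest D₀ τ Ds

AllInL : {s w : ℕ} → List (Layer s w) → (n : ℕ) → Strs (replicate n (Fin s)) → Set
AllInL D₀ zero    _        = ⊤
AllInL D₀ (suc n) (v , vs) = InL D₀ v × AllInL D₀ n vs

CoordsR : (s w : ℕ) → List ℕ → ℕ → List Set
CoordsR s w τ n = Layer s w ∷ (LayerAlphs s w τ ++ replicate n (Fin s))

RelR : (s w : ℕ) (τ : List ℕ) (n : ℕ) → Strs (CoordsR s w τ n) → Set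
RelR s w τ n (D₀ , rest) with splitStrs (LayerAlphs s w τ) (replicate n (Fin s)) rest
... | (Ds , vs) = Structural s w τ D₀ Ds × AllInL D₀ n vs

-- A tuple (D₀,…,D_m,v₁,…,v_n) is read column by column next to the layers of D₀, its longest
-- coordinate. Being an ODD is a condition on consecutive layers. Membership σ ∈ L(D) is decided by
-- running the subset construction of the nondeterministic automaton formed by the layers of D
-- alongside σ; membership in L(D₀)^{⊗a} is decided coordinatewise, plus the check that the last
-- column is not all #. The inclusion L(Dᵢ) ⊆ L(D₀)^{⊗aᵢ} says that no string is a counterexample,
-- i.e. it is the complement of the projection of an automaton accepting counterexamples. The
-- relation is the intersection of these regular conditions.

module Submission where

open import Defs
open import Data.Bool using (Bool; true; false; _∧_; _∨_; not; if_then_else_)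
open import Data.Bool.Properties using (∧-conicalˡ; ∧-conicalʳ) renaming (_≟_ to _≟ᵇ_)
open import Data.Empty using (⊥; ⊥-elim)
open import Data.Fin using (Fin; zero; suc; combine; remQuot; _≟_)
open import Data.Fin.Properties using (remQuot-combine)
open import Data.List using (List; []; _∷_; _++_; map; length; replicate; zip; zipWith; last)
open import Data.List.Properties
  using (length-map; length-++; length-++-≤ˡ; length-replicate; length-zipWith; ++-identityʳ;
         zipWith-replicate; map-++; map-∘; map-replicate; last-map)
open import Data.List.Relation.Unary.All using (All)
open import Data.Maybe using (Maybe; just; nothing) renaming (map to mapᴹ)
open import Data.Maybe.Properties using (just-injective) renaming (≡-dec to ≡-decᴹ)
open import Data.Nat using (ℕ; zero; suc; _+_; _*_; _∸_; _⊓_; _≤_; _<_; z≤n; s≤s)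
open import Data.Nat.Properties
  using (≤-refl; ≤-reflexive; suc-injective; m≤m+n; m+n∸m≡n; ⊓-idem; m+[n∸m]≡n; n∸n≡0;
         m≤n⇒m∸n≡0)
open import Data.Product using (∃; _×_; _,_; proj₁; proj₂; map₁; map₂) renaming (map to map×)
open import Data.Product.Function.NonDependent.Propositional using (_×-⇔_)
open import Data.Unit using (⊤; tt)
open import Data.Vec using (Vec; lookup; tabulate; head; tail) renaming ([] to []ᵛ; _∷_ to _∷ᵛ_)
open import Data.Vec.Properties using (lookup∘tabulate; ∷-injectiveʳ; ≡-dec)
open import Function using (id)
open import Function.Bundles using (_⇔_; mk⇔; Equivalence)
open import Function.Construct.Composition using (_⇔-∘_)
open import Function.Construct.Symmetry using (⇔-sym)
open import Relation.Binary.Definitions using (DecidableEquality)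
open import Relation.Binary.PropositionalEquality
open import Relation.Nullary using (¬_; Dec; yes; no; does)
open import Relation.Nullary.Decidable using (dec-true)

open Equivalence using (to; from)

-- Finite types and automata

record Finite (A : Set) : Set where
  field
    size          : ℕ
    encode        : A → Fin size
    decode        : Fin size → A
    decode-encode : ∀ x → decode (encode x) ≡ x
open Finite

Finite-Fin : (n : ℕ) → Finite (Fin n)
Finite-Fin n = record { size = n ; encode = id ; decode = id ; decode-encode = λ _ → refl }

Finite-retract : {A B : Set} (f : A → B) (g : B → A) → (∀ x → g (f x) ≡ x) → Finite B → Finite A
Finite-retract f g gf fin = record
  { size = size fin ; encode = λ x → encode fin (f x) ; decode = λ i → g (decode fin i)
  ; decode-encode = λ x → trans (cong g (decode-encode fin (f x))) (gf x) }

Finite-⊤ : Finite ⊤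
Finite-⊤ = Finite-retract (λ _ → zero) (λ _ → tt) (λ _ → refl) (Finite-Fin 1)

Finite-Maybe : {A : Set} → Finite A → Finite (Maybe A)
Finite-Maybe {A} fin = record
  { size = suc (size fin) ; encode = enc ; decode = dec ; decode-encode = dec-enc }
  where
  enc : Maybe A → Fin (suc (size fin))
  enc nothing  = zero
  enc (just x) = suc (encode fin x)
  dec : Fin (suc (size fin)) → Maybe A
  dec zero    = nothing
  dec (suc i) = just (decode fin i)
  dec-enc : ∀ x → dec (enc x) ≡ x
  dec-enc nothing  = refl
  dec-enc (just x) = cong just (decode-encode fin x)

Finite-Bool : Finite Bool
Finite-Bool = Finite-retract toMaybe fromMaybe fromMaybe-toMaybe (Finite-Maybe Finite-⊤)
  where
  toMaybe : Bool → Maybe ⊤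
  toMaybe false = nothing
  toMaybe true  = just tt
  fromMaybe : Maybe ⊤ → Bool
  fromMaybe nothing  = false
  fromMaybe (just _) = true
  fromMaybe-toMaybe : ∀ b → fromMaybe (toMaybe b) ≡ b
  fromMaybe-toMaybe false = refl
  fromMaybe-toMaybe true  = refl

Finite-× : {A B : Set} → Finite A → Finite B → Finite (A × B)
Finite-× {A} {B} finA finB = record
  { size = size finA * size finB ; encode = enc ; decode = dec ; decode-encode = dec-enc }
  where
  enc : A × B → Fin (size finA * size finB)
  enc (x , y) = combine (encode finA x) (encode finB y)
  dec : Fin (size finA * size finB) → A × B
  dec i = map× (decode finA) (decode finB) (remQuot (size finB) i)
  dec-enc : ∀ p → dec (enc p) ≡ p
  dec-enc (x , y) =
    trans (cong (map× (decode finA) (decode finB)) (remQuot-combine (encode finA x) (encode finB y)))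
          (cong₂ _,_ (decode-encode finA x) (decode-encode finB y))

Finite-Vec : {A : Set} → Finite A → (n : ℕ) → Finite (Vec A n)
Finite-Vec     fin zero    = Finite-retract (λ _ → tt) (λ _ → []ᵛ) (λ { []ᵛ → refl }) Finite-⊤
Finite-Vec {A} fin (suc n) = Finite-retract uncons (λ (x , xs) → x ∷ᵛ xs) (λ { (x ∷ᵛ xs) → refl })
                               (Finite-× fin (Finite-Vec fin n))
  where
  uncons : Vec A (suc n) → A × Vec A n
  uncons (x ∷ᵛ xs) = x , xs

anyᶠ : (n : ℕ) → (Fin n → Bool) → Bool
anyᶠ zero    f = false
anyᶠ (suc n) f = f zero ∨ anyᶠ n (λ i → f (suc i))

anyᶠ-true : ∀ n (f : Fin n → Bool) → anyᶠ n f ≡ true ⇔ (∃ λ i → f i ≡ true)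
anyᶠ-true n f = mk⇔ (witness n f) (λ (i , fi) → intro n f i fi)
  where
  witness : ∀ n (f : Fin n → Bool) → anyᶠ n f ≡ true → ∃ λ i → f i ≡ true
  witness (suc n) f any with f zero in eq
  ... | true  = zero , eq
  ... | false with witness n (λ i → f (suc i)) any
  ...   | i , fi = suc i , fi
  intro : ∀ n (f : Fin n → Bool) i → f i ≡ true → anyᶠ n f ≡ true
  intro (suc n) f zero    fi rewrite fi = refl
  intro (suc n) f (suc i) fi with f zero
  ... | true  = refl
  ... | false = intro n (λ j → f (suc j)) i fi

∧-true : ∀ {a b} → a ∧ b ≡ true ⇔ (a ≡ true × b ≡ true)
∧-true {a} {b} =
  mk⇔ (λ ab → ∧-conicalˡ a b ab , ∧-conicalʳ a b ab) (λ (a≡ , b≡) → cong₂ _∧_ a≡ b≡)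

≟-true : ∀ {n} (i j : Fin n) → does (i ≟ j) ≡ true → i ≡ j
≟-true i j eq with i ≟ j
... | yes i≡j = i≡j

record Automaton (C : Set) : Set₁ where
  field
    State     : Set
    finite    : Finite State
    initial   : State
    step      : State → C → State
    accepting : State → Bool
open Automaton

runFrom : {C : Set} (A : Automaton C) → State A → List C → State A
runFrom A q []      = q
runFrom A q (c ∷ x) = runFrom A (step A q c) x

AcceptsFrom : {C : Set} (A : Automaton C) → State A → List C → Set
AcceptsFrom A q x = accepting A (runFrom A q x) ≡ true

Accepted : {C : Set} → Automaton C → List C → Set
Accepted A = AcceptsFrom A (initial A)

accepted? : {C : Set} (A : Automaton C) (x : List C) → Dec (Accepted A x)
accepted? A x with accepting A (runFrom A (initial A) x)
... | true  = yes refl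
... | false = no (λ ())

toDFA : {C : Set} → Automaton C → DFA C
toDFA A = record
  { nStates = size (finite A)
  ; start   = encode (finite A) (initial A)
  ; δ       = λ i c → encode (finite A) (step A (decode (finite A) i) c)
  ; final   = λ i → accepting A (decode (finite A) i) }

run-toDFA : {C : Set} (A : Automaton C) (q : State A) (x : List C) →
            run (toDFA A) (encode (finite A) q) x ≡ encode (finite A) (runFrom A q x)
run-toDFA A q []      = refl
run-toDFA A q (c ∷ x) rewrite decode-encode (finite A) q = run-toDFA A (step A q c) x

accepts-toDFA : {C : Set} (A : Automaton C) (x : List C) → Accepts (toDFA A) x ⇔ Accepted A x
accepts-toDFA A x
  rewrite run-toDFA A (initial A) x | decode-encode (finite A) (runFrom A (initial A) x) = mk⇔ id id

universal : {C : Set} → Automaton C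
universal = record
  { State = ⊤ ; finite = Finite-⊤ ; initial = tt ; step = λ _ _ → tt ; accepting = λ _ → true }

_∩ᴬ_ : {C : Set} → Automaton C → Automaton C → Automaton C
A ∩ᴬ B = record
  { State     = State A × State B
  ; finite    = Finite-× (finite A) (finite B)
  ; initial   = initial A , initial B
  ; step      = λ (p , q) c → step A p c , step B q c
  ; accepting = λ (p , q) → accepting A p ∧ accepting B q }

run-∩ᴬ : {C : Set} (A B : Automaton C) (p : State A) (q : State B) (x : List C) →
         runFrom (A ∩ᴬ B) (p , q) x ≡ (runFrom A p x , runFrom B q x)
run-∩ᴬ A B p q []      = refl
run-∩ᴬ A B p q (c ∷ x) = run-∩ᴬ A B (step A p c) (step B q c) x

accepted-∩ᴬ : {C : Set} (A B : Automaton C) (x : List C) →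
              Accepted (A ∩ᴬ B) x ⇔ (Accepted A x × Accepted B x)
accepted-∩ᴬ A B x rewrite run-∩ᴬ A B (initial A) (initial B) x = ∧-true

comap : {C C′ : Set} → (C′ → C) → Automaton C → Automaton C′
comap h A = record
  { State = State A ; finite = finite A ; initial = initial A
  ; step = λ q c → step A q (h c) ; accepting = accepting A }

run-comap : {C C′ : Set} (h : C′ → C) (A : Automaton C) (q : State A) (x : List C′) →
            runFrom (comap h A) q x ≡ runFrom A q (map h x)
run-comap h A q []      = refl
run-comap h A q (c ∷ x) = run-comap h A (step A q (h c)) x

accepted-comap : {C C′ : Set} (h : C′ → C) (A : Automaton C) {x : List C′} {y : List C} →
                 map h x ≡ y → Accepted (comap h A) x ⇔ Accepted A y
accepted-comap h A {x} refl rewrite run-comap h A (initial A) x = mk⇔ id id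

complement : {C : Set} → Automaton C → Automaton C
complement A = record
  { State = State A ; finite = finite A ; initial = initial A
  ; step = step A ; accepting = λ q → not (accepting A q) }

run-complement : {C : Set} (A : Automaton C) (q : State A) (x : List C) →
                 runFrom (complement A) q x ≡ runFrom A q x
run-complement A q []      = refl
run-complement A q (c ∷ x) = run-complement A (step A q c) x

accepted-complement : {C : Set} (A : Automaton C) (x : List C) →
                      Accepted (complement A) x ⇔ (¬ Accepted A x)
accepted-complement A x rewrite run-complement A (initial A) x with accepting A (runFrom A (initial A) x)
... | true  = mk⇔ (λ ()) (λ ¬acc → ⊥-elim (¬acc refl))
... | false = mk⇔ (λ _ ()) (λ _ → refl)

-- The subset construction, on sets of indices of states of A.
module Projection {C D : Set} (finD : Finite D) (A : Automaton (C × D)) where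

  private
    N = size (finite A)
    index = encode (finite A)
    state = decode (finite A)

    AcceptsFrom-≡ : ∀ {q q′} z → q ≡ q′ → AcceptsFrom A q z → AcceptsFrom A q′ z
    AcceptsFrom-≡ z refl acc = acc

  successors : Vec Bool N → C → Vec Bool N
  successors S c = tabulate λ j → anyᶠ N λ i → lookup S i ∧
    anyᶠ (size finD) λ e → does (index (step A (state i) (c , decode finD e)) ≟ j)

  start : Vec Bool N
  start = tabulate λ j → does (index (initial A) ≟ j)

  project : Automaton C
  project = record
    { State     = Vec Bool N
    ; finite    = Finite-Vec Finite-Bool N
    ; initial   = start
    ; step      = successors
    ; accepting = λ S → anyᶠ N λ i → lookup S i ∧ accepting A (state i) }

  start-∋ : ∀ i → lookup start i ≡ true ⇔ i ≡ index (initial A)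
  start-∋ i = mk⇔
    (λ h → sym (≟-true _ _ (trans (sym (lookup∘tabulate _ i)) h)))
    (λ { refl → trans (lookup∘tabulate _ i) (dec-true (i ≟ i) refl) })

  successors-∋ : ∀ S c j → lookup (successors S c) j ≡ true ⇔
                 (∃ λ i → ∃ λ d → lookup S i ≡ true × index (step A (state i) (c , d)) ≡ j)
  successors-∋ S c j = mk⇔ out into
    where
    out : lookup (successors S c) j ≡ true → _
    out h with to (anyᶠ-true N _) (trans (sym (lookup∘tabulate _ j)) h)
    ... | i , h′ with to ∧-true h′
    ...   | Si , h″ with to (anyᶠ-true (size finD) _) h″
    ...     | e , eq = i , decode finD e , Si , ≟-true _ _ eq
    into : _ → lookup (successors S c) j ≡ true
    into (i , d , Si , refl) = trans (lookup∘tabulate _ j) (from (anyᶠ-true N _) (i ,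
      from ∧-true (Si , from (anyᶠ-true (size finD) _) (encode finD d ,
        subst (λ d′ → does (index (step A (state i) (c , d′)) ≟ j) ≡ true)
              (sym (decode-encode finD d)) (dec-true (j ≟ j) refl)))))

  acceptsFrom-project : ∀ S (x : List C) → AcceptsFrom project S x ⇔
    (∃ λ i → ∃ λ (ys : List D) →
       lookup S i ≡ true × length ys ≡ length x × AcceptsFrom A (state i) (zip x ys))
  acceptsFrom-project S [] = mk⇔ out into
    where
    out : AcceptsFrom project S [] → _
    out h with to (anyᶠ-true N _) h
    ... | i , h′ = i , [] , proj₁ (to ∧-true h′) , refl , proj₂ (to ∧-true h′)
    into : _ → AcceptsFrom project S []
    into (i , [] , Si , _ , acc) = from (anyᶠ-true N _) (i , from ∧-true (Si , acc))
  acceptsFrom-project S (c ∷ x) = mk⇔ out into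
    where
    IH = acceptsFrom-project (successors S c) x
    out : AcceptsFrom project S (c ∷ x) → _
    out h with to IH h
    ... | j , ys , S′j , len , acc with to (successors-∋ S c j) S′j
    ...   | i , d , Si , refl =
            i , d ∷ ys , Si , cong suc len , AcceptsFrom-≡ (zip x ys) (decode-encode (finite A) _) acc
    into : _ → AcceptsFrom project S (c ∷ x)
    into (i , d ∷ ys , Si , len , acc) = from IH
      ( index q , ys , from (successors-∋ S c (index q)) (i , d , Si , refl) , suc-injective len
      , AcceptsFrom-≡ (zip x ys) (sym (decode-encode (finite A) q)) acc)
      where
      q = step A (state i) (c , d)

  accepted-project : (x : List C) → Accepted project x ⇔
                     (∃ λ (ys : List D) → length ys ≡ length x × Accepted A (zip x ys))
  accepted-project x = mk⇔ out into
    where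
    out : Accepted project x → _
    out h with to (acceptsFrom-project start x) h
    ... | i , ys , start∋i , len , acc = ys , len , AcceptsFrom-≡ (zip x ys) state-i acc
      where
      state-i : state i ≡ initial A
      state-i = trans (cong state (to (start-∋ i) start∋i)) (decode-encode (finite A) (initial A))
    into : _ → Accepted project x
    into (ys , len , acc) = from (acceptsFrom-project start x)
      ( index (initial A) , ys , from (start-∋ _) refl , len
      , AcceptsFrom-≡ (zip x ys) (sym (decode-encode (finite A) _)) acc)

-- Padded convolutions

padTo : {A : Set} → ℕ → List A → List (Maybe A)
padTo k u = map just u ++ replicate (k ∸ length u) nothing

length-padTo : {A : Set} (k : ℕ) (u : List A) → length u ≤ k → length (padTo k u) ≡ k
length-padTo k u u≤k = begin
  length (map just u ++ replicate (k ∸ length u) nothing)  ≡⟨ length-++ (map just u) ⟩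
  length (map just u) + length (replicate (k ∸ length u) nothing)
    ≡⟨ cong₂ _+_ (length-map just u) (length-replicate (k ∸ length u)) ⟩
  length u + (k ∸ length u)                                ≡⟨ m+[n∸m]≡n u≤k ⟩
  k                                                        ∎
  where open ≡-Reasoning

padTo-full : {A : Set} {k : ℕ} (u : List A) → length u ≡ k → padTo k u ≡ map just u
padTo-full u refl rewrite n∸n≡0 (length u) = ++-identityʳ (map just u)

length-zipWith-≡ : {A B C : Set} (f : A → B → C) (xs : List A) (ys : List B) {k : ℕ} →
                   length xs ≡ k → length ys ≡ k → length (zipWith f xs ys) ≡ k
length-zipWith-≡ f xs ys xs≡ ys≡ =
  trans (length-zipWith f xs ys) (trans (cong₂ _⊓_ xs≡ ys≡) (⊓-idem _))

padWith : {A : Set} → A → ℕ → List A → List A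
padWith h k xs = xs ++ replicate (k ∸ length xs) h

padWith-long : {A : Set} (h : A) {k : ℕ} (xs : List A) → k ≤ length xs → padWith h k xs ≡ xs
padWith-long h xs k≤ rewrite m≤n⇒m∸n≡0 k≤ = ++-identityʳ xs

BoundedBy : (As : List Set) → ℕ → Strs As → Set
BoundedBy []       k _        = ⊤
BoundedBy (A ∷ As) k (u , us) = length u ≤ k × BoundedBy As k us

convTo : (As : List Set) → ℕ → Strs As → List (Col As)
convTo []       k _        = replicate k tt
convTo (A ∷ As) k (u , us) = zip (padTo k u) (convTo As k us)

length-convTo : ∀ As k t → BoundedBy As k t → length (convTo As k t) ≡ k
length-convTo []       k t        _          = length-replicate k
length-convTo (A ∷ As) k (u , us) (u≤ , us≤) =
  length-zipWith-≡ _,_ (padTo k u) (convTo As k us) (length-padTo k u u≤) (length-convTo As k us us≤)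

length-padConsH : {A : Set} (As : List Set) (u : List A) (cs : List (Col As)) →
                  length u ≤ length (padConsH As u cs)
length-padConsH As []      cs       = z≤n
length-padConsH As (x ∷ u) []       = s≤s (length-padConsH As u [])
length-padConsH As (x ∷ u) (c ∷ cs) = s≤s (length-padConsH As u cs)

padWith-padConsH : {A : Set} (As : List Set) (u : List A) (cs : List (Col As)) (k : ℕ) →
                   length u ≤ k → length cs ≤ k →
                   padWith (hashCol (A ∷ As)) k (padConsH As u cs)
                     ≡ zip (padTo k u) (padWith (hashCol As) k cs)
padWith-padConsH As []      []       k       _        _        =
  sym (zipWith-replicate k _,_ nothing (hashCol As))
padWith-padConsH As (x ∷ u) []       (suc k) (s≤s u≤) _        =
  cong (_ ∷_) (padWith-padConsH As u [] k u≤ z≤n)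
padWith-padConsH As []      (c ∷ cs) (suc k) _        (s≤s c≤) =
  cong (_ ∷_) (padWith-padConsH As [] cs k z≤n c≤)
padWith-padConsH As (x ∷ u) (c ∷ cs) (suc k) (s≤s u≤) (s≤s c≤) =
  cong (_ ∷_) (padWith-padConsH As u cs k u≤ c≤)

padWith-conv : ∀ As k t → BoundedBy As k t → padWith (hashCol As) k (conv As t) ≡ convTo As k t
padWith-conv []       k t        _          = refl
padWith-conv (A ∷ As) k (u , us) (u≤ , us≤) =
  trans (padWith-padConsH As u (conv As us) k u≤ conv≤) (cong (zip (padTo k u)) IH)
  where
  IH = padWith-conv As k us us≤
  conv≤ : length (conv As us) ≤ k
  conv≤ = subst (length (conv As us) ≤_) (trans (cong length IH) (length-convTo As k us us≤))
                (length-++-≤ˡ (conv As us))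

conv-longest : {A : Set} (As : List Set) (u : List A) (us : Strs As) → BoundedBy As (length u) us →
               conv (A ∷ As) (u , us) ≡ zip (map just u) (convTo As (length u) us)
conv-longest {A} As u us us≤ = begin
  conv (A ∷ As) (u , us)
    ≡⟨ sym (padWith-long (hashCol (A ∷ As)) _ (length-padConsH As u (conv As us))) ⟩
  padWith (hashCol (A ∷ As)) (length u) (conv (A ∷ As) (u , us))
    ≡⟨ padWith-conv (A ∷ As) (length u) (u , us) (≤-refl , us≤) ⟩
  zip (padTo (length u) u) (convTo As (length u) us)
    ≡⟨ cong (λ v → zip v (convTo As (length u) us)) (padTo-full u refl) ⟩
  zip (map just u) (convTo As (length u) us)
    ∎
  where open ≡-Reasoning

tensorTo : {A : Set} {a : ℕ} → ℕ → Vec (List A) a → List (Vec (Maybe A) a)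
tensorTo k []ᵛ       = replicate k []ᵛ
tensorTo k (u ∷ᵛ us) = zipWith _∷ᵛ_ (padTo k u) (tensorTo k us)

length-tensorTo : {A : Set} {a : ℕ} (k : ℕ) (us : Vec (List A) a) → AllVec (λ u → length u ≤ k) us →
                  length (tensorTo k us) ≡ k
length-tensorTo k []ᵛ       _          = length-replicate k
length-tensorTo k (u ∷ᵛ us) (u≤ , us≤) =
  length-zipWith-≡ _∷ᵛ_ (padTo k u) (tensorTo k us) (length-padTo k u u≤) (length-tensorTo k us us≤)

padWith-padCons : {A : Set} {a : ℕ} (u : List A) (cs : List (Vec (Maybe A) a)) (k : ℕ) →
                  length u ≤ k → length cs ≤ k →
                  padWith (allHash (suc a)) k (padCons u cs)
                    ≡ zipWith _∷ᵛ_ (padTo k u) (padWith (allHash a) k cs)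
padWith-padCons {a = a} []      []       k       _        _        =
  sym (zipWith-replicate k _∷ᵛ_ nothing (allHash a))
padWith-padCons         (x ∷ u) []       (suc k) (s≤s u≤) _        =
  cong (_ ∷_) (padWith-padCons u [] k u≤ z≤n)
padWith-padCons         []      (c ∷ cs) (suc k) _        (s≤s c≤) =
  cong (_ ∷_) (padWith-padCons [] cs k z≤n c≤)
padWith-padCons         (x ∷ u) (c ∷ cs) (suc k) (s≤s u≤) (s≤s c≤) =
  cong (_ ∷_) (padWith-padCons u cs k u≤ c≤)

padWith-tensor : {A : Set} {a : ℕ} (k : ℕ) (us : Vec (List A) a) → AllVec (λ u → length u ≤ k) us →
                 padWith (allHash a) k (tensor us) ≡ tensorTo k us
padWith-tensor k []ᵛ       _          = refl
padWith-tensor k (u ∷ᵛ us) (u≤ , us≤) =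
  trans (padWith-padCons u (tensor us) k u≤ tensor≤) (cong (zipWith _∷ᵛ_ (padTo k u)) IH)
  where
  IH = padWith-tensor k us us≤
  tensor≤ : length (tensor us) ≤ k
  tensor≤ = subst (length (tensor us) ≤_) (trans (cong length IH) (length-tensorTo k us us≤))
                  (length-++-≤ˡ (tensor us))

last-padCons : {A : Set} {a : ℕ} (u : List A) (cs : List (Vec (Maybe A) a)) →
               last cs ≢ just (allHash a) → last (padCons u cs) ≢ just (allHash (suc a))
last-padCons []          []           _ ()
last-padCons (x ∷ [])    []           _ ()
last-padCons (x ∷ y ∷ u) []           _ = last-padCons (y ∷ u) [] (λ ())
last-padCons []          (c ∷ [])     h = λ eq → h (cong just (∷-injectiveʳ (just-injective eq)))
last-padCons []          (c ∷ d ∷ cs) h = last-padCons [] (d ∷ cs) h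
last-padCons (x ∷ [])    (c ∷ [])     _ ()
last-padCons (x ∷ y ∷ u) (c ∷ [])     _ = last-padCons (y ∷ u) [] (λ ())
last-padCons (x ∷ [])    (c ∷ d ∷ cs) h = last-padCons [] (d ∷ cs) h
last-padCons (x ∷ y ∷ u) (c ∷ d ∷ cs) h = last-padCons (y ∷ u) (d ∷ cs) h

last-tensor : {A : Set} {a : ℕ} (us : Vec (List A) a) → last (tensor us) ≢ just (allHash a)
last-tensor []ᵛ       ()
last-tensor (u ∷ᵛ us) = last-padCons u (tensor us) (last-tensor us)

module Trailing {X : Set} (_≟ₓ_ : DecidableEquality X) (h : X) where

  consDropping : X → List X → List X
  consDropping c []      = if does (c ≟ₓ h) then [] else c ∷ []
  consDropping c (d ∷ q) = c ∷ d ∷ q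

  dropTrailing : List X → List X
  dropTrailing []      = []
  dropTrailing (c ∷ p) = consDropping c (dropTrailing p)

  dropTrailing-replicate : ∀ i → dropTrailing (replicate i h) ≡ []
  dropTrailing-replicate zero = refl
  dropTrailing-replicate (suc i) rewrite dropTrailing-replicate i | dec-true (h ≟ₓ h) refl = refl

  dropTrailing-++-replicate : ∀ p i → dropTrailing (p ++ replicate i h) ≡ dropTrailing p
  dropTrailing-++-replicate []      i = dropTrailing-replicate i
  dropTrailing-++-replicate (c ∷ p) i = cong (consDropping c) (dropTrailing-++-replicate p i)

  dropTrailing-last : ∀ p → last p ≢ just h → dropTrailing p ≡ p
  dropTrailing-last []          _ = refl
  dropTrailing-last (c ∷ [])    c≢h with c ≟ₓ h
  ... | yes c≡h = ⊥-elim (c≢h (cong just c≡h))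
  ... | no  _   = refl
  dropTrailing-last (c ∷ d ∷ p) p≢h = cong (consDropping c) (dropTrailing-last (d ∷ p) p≢h)

  ++-replicate-cancel : ∀ p q i j → p ++ replicate i h ≡ q ++ replicate j h →
                        last p ≢ just h → last q ≢ just h → p ≡ q
  ++-replicate-cancel p q i j eq p≢h q≢h = begin
    p                                 ≡⟨ sym (dropTrailing-last p p≢h) ⟩
    dropTrailing p                    ≡⟨ sym (dropTrailing-++-replicate p i) ⟩
    dropTrailing (p ++ replicate i h) ≡⟨ cong dropTrailing eq ⟩
    dropTrailing (q ++ replicate j h) ≡⟨ dropTrailing-++-replicate q j ⟩
    dropTrailing q                    ≡⟨ dropTrailing-last q q≢h ⟩
    q                                 ∎
    where open ≡-Reasoning

-- Recognising ODDs and their languages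

module ODDRecognizer (g w : ℕ) where

  -- nothing: reject; just nothing: no layer read yet;
  -- just (just (r , φ)): the last layer read has right set r and finality flag φ.
  OddState : Set
  OddState = Maybe (Maybe (Vec Bool w × Bool))

  linked : Vec Bool w × Bool → Layer g w → Bool
  linked (r′ , φ′) B = not φ′ ∧ (not (ι B) ∧ does (≡-dec _≟ᵇ_ (ℓ B) r′))

  linked-true : ∀ r′ φ′ B →
                linked (r′ , φ′) B ≡ true ⇔ (φ′ ≡ false × ι B ≡ false × ℓ B ≡ r′)
  linked-true r′ φ′ B with φ′ | ι B | ≡-dec _≟ᵇ_ (ℓ B) r′
  ... | false | false | yes ℓ≡r = mk⇔ (λ _ → refl , refl , ℓ≡r) (λ _ → refl)
  ... | false | false | no  ℓ≢r = mk⇔ (λ ()) (λ (_ , _ , ℓ≡r) → ⊥-elim (ℓ≢r ℓ≡r))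
  ... | false | true  | _        = mk⇔ (λ ()) (λ ())
  ... | true  | _     | _        = mk⇔ (λ ()) (λ ())

  after : Layer g w → OddState
  after B = just (just (r B , φ B))

  enter : Bool → Layer g w → OddState
  enter b B = if b then after B else nothing

  recognizer : Automaton (Maybe (Layer g w))
  recognizer = record
    { State     = OddState
    ; finite    = Finite-Maybe (Finite-Maybe (Finite-× (Finite-Vec Finite-Bool w) Finite-Bool))
    ; initial   = just nothing
    ; step      = δ
    ; accepting = λ { (just (just (_ , φ′))) → φ′ ; _ → false } }
    where
    δ : OddState → Maybe (Layer g w) → OddState
    δ (just nothing)         (just B) = enter (ι B) B
    δ (just (just previous)) (just B) = enter (linked previous B) B
    δ _                      _        = nothing

  rejecting : ∀ x → ¬ AcceptsFrom recognizer nothing x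
  rejecting []      ()
  rejecting (_ ∷ x) = rejecting x

  acceptsFrom-enter : ∀ b B x → AcceptsFrom recognizer (enter b B) x ⇔
                      (b ≡ true × AcceptsFrom recognizer (after B) x)
  acceptsFrom-enter true  B x = mk⇔ (refl ,_) proj₂
  acceptsFrom-enter false B x = mk⇔ (λ h → ⊥-elim (rejecting x h)) (λ ())

  acceptsFrom-after : ∀ B x → AcceptsFrom recognizer (after B) x ⇔
                      (∃ λ Bs → x ≡ map just Bs × Chain B Bs)
  acceptsFrom-after B []            = mk⇔ (λ φB → [] , refl , φB) (λ { ([] , refl , φB) → φB })
  acceptsFrom-after B (nothing ∷ x) =
    mk⇔ (λ h → ⊥-elim (rejecting x h)) (λ { ([] , () , _) ; (_ ∷ _ , () , _) })
  acceptsFrom-after B (just B′ ∷ x) = mk⇔ out into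
    where
    out : AcceptsFrom recognizer (after B) (just B′ ∷ x) → _
    out h with to (acceptsFrom-enter _ B′ x) h
    ... | link , h′ with to (acceptsFrom-after B′ x) h′ | to (linked-true (r B) (φ B) B′) link
    ...   | Bs , refl , chain | φB , ιB′ , ℓB′ = B′ ∷ Bs , refl , φB , ιB′ , ℓB′ , chain
    into : _ → AcceptsFrom recognizer (after B) (just B′ ∷ x)
    into (_ ∷ Bs , refl , φB , ιB′ , ℓB′ , chain) = from (acceptsFrom-enter _ B′ x)
      ( from (linked-true (r B) (φ B) B′) (φB , ιB′ , ℓB′)
      , from (acceptsFrom-after B′ x) (Bs , refl , chain))

  accepted-recognizer : ∀ x → Accepted recognizer x ⇔ (∃ λ D → x ≡ map just D × IsODD D)
  accepted-recognizer []            = mk⇔ (λ ()) (λ { ([] , _ , ()) })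
  accepted-recognizer (nothing ∷ x) =
    mk⇔ (λ h → ⊥-elim (rejecting x h)) (λ { ([] , () , _) ; (_ ∷ _ , () , _) })
  accepted-recognizer (just B ∷ x)  = mk⇔ out into
    where
    out : Accepted recognizer (just B ∷ x) → _
    out h with to (acceptsFrom-enter (ι B) B x) h
    ... | ιB , h′ with to (acceptsFrom-after B x) h′
    ...   | Bs , refl , chain = B ∷ Bs , refl , ιB , chain
    into : _ → Accepted recognizer (just B ∷ x)
    into (_ ∷ Bs , refl , ιB , chain) =
      from (acceptsFrom-enter (ι B) B x) (ιB , from (acceptsFrom-after B x) (Bs , refl , chain))

IsODD-nonempty : {g w : ℕ} (D : List (Layer g w)) → IsODD D → 0 < length D
IsODD-nonempty (_ ∷ _) _ = s≤s z≤n

module PaddedShape (X : Set) where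

  data Phase : Set where
    start letters padding reject : Phase

  finite-Phase : Finite Phase
  finite-Phase = Finite-retract bits unbits unbits-bits (Finite-× Finite-Bool Finite-Bool)
    where
    bits : Phase → Bool × Bool
    bits start   = false , false
    bits letters = false , true
    bits padding = true  , false
    bits reject  = true  , true
    unbits : Bool × Bool → Phase
    unbits (false , false) = start
    unbits (false , true)  = letters
    unbits (true  , false) = padding
    unbits (true  , true)  = reject
    unbits-bits : ∀ p → unbits (bits p) ≡ p
    unbits-bits start   = refl
    unbits-bits letters = refl
    unbits-bits padding = refl
    unbits-bits reject  = refl

  shape : Automaton (Maybe X)
  shape = record
    { State = Phase ; finite = finite-Phase ; initial = start ; step = δ
    ; accepting = λ { letters → true ; padding → true ; _ → false } }
    where
    δ : Phase → Maybe X → Phase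
    δ start   (just _) = letters
    δ letters (just _) = letters
    δ letters nothing  = padding
    δ padding nothing  = padding
    δ _       _        = reject

  rejecting : ∀ y → ¬ AcceptsFrom shape reject y
  rejecting []      ()
  rejecting (_ ∷ y) = rejecting y

  acceptsFrom-padding : ∀ y → AcceptsFrom shape padding y ⇔ (∃ λ j → y ≡ replicate j nothing)
  acceptsFrom-padding []            = mk⇔ (λ _ → 0 , refl) (λ _ → refl)
  acceptsFrom-padding (just _ ∷ y)  =
    mk⇔ (λ h → ⊥-elim (rejecting y h)) (λ { (zero , ()) ; (suc _ , ()) })
  acceptsFrom-padding (nothing ∷ y) = mk⇔
    (λ h → let j , eq = to (acceptsFrom-padding y) h in suc j , cong (nothing ∷_) eq)
    (λ { (suc j , refl) → from (acceptsFrom-padding y) (j , refl) })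

  acceptsFrom-letters : ∀ y → AcceptsFrom shape letters y ⇔
                        (∃ λ σ → ∃ λ j → y ≡ map just σ ++ replicate j nothing)
  acceptsFrom-letters []            = mk⇔ (λ _ → [] , 0 , refl) (λ _ → refl)
  acceptsFrom-letters (just c ∷ y)  = mk⇔
    (λ h → let σ , j , eq = to (acceptsFrom-letters y) h in c ∷ σ , j , cong (just c ∷_) eq)
    (λ { ([] , zero , ()) ; ([] , suc _ , ())
       ; (_ ∷ σ , j , refl) → from (acceptsFrom-letters y) (σ , j , refl) })
  acceptsFrom-letters (nothing ∷ y) = mk⇔
    (λ h → let j , eq = to (acceptsFrom-padding y) h in [] , suc j , cong (nothing ∷_) eq)
    (λ { ([] , suc j , refl) → from (acceptsFrom-padding y) (j , refl) ; (_ ∷ _ , _ , ()) })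

  accepted-shape : ∀ y → Accepted shape y ⇔
                   (∃ λ σ → ∃ λ j → 0 < length σ × y ≡ map just σ ++ replicate j nothing)
  accepted-shape []            = mk⇔ (λ ()) (λ { ([] , _ , () , _) ; (_ ∷ _ , _ , _ , ()) })
  accepted-shape (nothing ∷ y) =
    mk⇔ (λ h → ⊥-elim (rejecting y h)) (λ { ([] , _ , () , _) ; (_ ∷ _ , _ , _ , ()) })
  accepted-shape (just c ∷ y)  = mk⇔
    (λ h → let σ , j , eq = to (acceptsFrom-letters y) h in
             c ∷ σ , j , s≤s z≤n , cong (just c ∷_) eq)
    (λ { ([] , _ , () , _) ; (_ ∷ σ , j , _ , refl) → from (acceptsFrom-letters y) (σ , j , refl) })

map-proj₁-zip : {A B : Set} (xs : List A) (ys : List B) → length xs ≡ length ys →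
                map proj₁ (zip xs ys) ≡ xs
map-proj₁-zip []       []       _   = refl
map-proj₁-zip (x ∷ xs) (y ∷ ys) len = cong (x ∷_) (map-proj₁-zip xs ys (suc-injective len))

map-proj₂-zip : {A B : Set} (xs : List A) (ys : List B) → length xs ≡ length ys →
                map proj₂ (zip xs ys) ≡ ys
map-proj₂-zip []       []       _   = refl
map-proj₂-zip (x ∷ xs) (y ∷ ys) len = cong (y ∷_) (map-proj₂-zip xs ys (suc-injective len))

zip-map-proj₁-map-proj₂ : {A B : Set} (z : List (A × B)) → zip (map proj₁ z) (map proj₂ z) ≡ z
zip-map-proj₁-map-proj₂ []      = refl
zip-map-proj₁-map-proj₂ (p ∷ z) = cong (p ∷_) (zip-map-proj₁-map-proj₂ z)

map-map₁-zip : {A A′ B : Set} (f : A → A′) (xs : List A) (ys : List B) →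
               map (map₁ f) (zip xs ys) ≡ zip (map f xs) ys
map-map₁-zip f []       ys       = refl
map-map₁-zip f (x ∷ xs) []       = refl
map-map₁-zip f (x ∷ xs) (y ∷ ys) = cong (_ ∷_) (map-map₁-zip f xs ys)

map-map₂-zip : {A B B′ : Set} (f : B → B′) (xs : List A) (ys : List B) →
               map (map₂ f) (zip xs ys) ≡ zip xs (map f ys)
map-map₂-zip f []       ys       = refl
map-map₂-zip f (x ∷ xs) []       = refl
map-map₂-zip f (x ∷ xs) (y ∷ ys) = cong (_ ∷_) (map-map₂-zip f xs ys)

accepted-ignoring-track : {T X : Set} (A : Automaton X) (t : List T) (y : List X) → length t ≡ length y →
                          Accepted (comap proj₂ A) (zip t y) ⇔ Accepted A y
accepted-ignoring-track A t y len = accepted-comap proj₂ A (map-proj₂-zip t y len)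

accepted-comap-map₂ : {T X Y : Set} (f : Y → X) (A : Automaton (T × X)) (t : List T) (y : List Y) →
                      Accepted (comap (map₂ f) A) (zip t y) ⇔ Accepted A (zip t (map f y))
accepted-comap-map₂ f A t y = accepted-comap (map₂ f) A (map-map₂-zip f t y)

_⊗ᵗ_ : {T X Y : Set} → Automaton (T × X) → Automaton (T × Y) → Automaton (T × (X × Y))
A ⊗ᵗ B = comap (map₂ proj₁) A ∩ᴬ comap (map₂ proj₂) B

accepted-⊗ᵗ : {T X Y : Set} (A : Automaton (T × X)) (B : Automaton (T × Y))
              (t : List T) (z : List (X × Y)) →
              Accepted (A ⊗ᵗ B) (zip t z) ⇔
              (Accepted A (zip t (map proj₁ z)) × Accepted B (zip t (map proj₂ z)))
accepted-⊗ᵗ A B t z =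
  (accepted-comap-map₂ proj₁ A t z ×-⇔ accepted-comap-map₂ proj₂ B t z)
  ⇔-∘ accepted-∩ᴬ (comap (map₂ proj₁) A) (comap (map₂ proj₂) B) (zip t z)

Runs : {g w : ℕ} → List (Layer g w) → List (Maybe (Fin g)) → Set
Runs []       y = ⊥
Runs (B ∷ Bs) y = ∃ λ p → lookup (I B) p ≡ true × Path (B ∷ Bs) y p

InL⇔Runs : {g w : ℕ} (D : List (Layer g w)) (σ : List (Fin g)) →
           InL D σ ⇔ (0 < length σ × length σ ≤ length D × Runs D (pad (length D) σ))
InL⇔Runs []      σ = mk⇔ (λ ()) (λ { (_ , _ , ()) })
InL⇔Runs (_ ∷ _) σ = mk⇔ id id

InL-nonempty : {g w : ℕ} (D : List (Layer g w)) (σ : List (Fin g)) → InL D σ → 0 < length σ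
InL-nonempty D σ σ∈ = proj₁ (to (InL⇔Runs D σ) σ∈)

InL-bounded : {g w : ℕ} (D : List (Layer g w)) (σ : List (Fin g)) → InL D σ → length σ ≤ length D
InL-bounded D σ σ∈ = proj₁ (proj₂ (to (InL⇔Runs D σ) σ∈))

padTo-of-length : {A : Set} (k : ℕ) (σ : List A) (j : ℕ) →
                  length (map just σ ++ replicate j nothing) ≡ k →
                  length σ ≤ k × map just σ ++ replicate j nothing ≡ padTo k σ
padTo-of-length k σ j len =
  subst (length σ ≤_) σ+j≡k (m≤m+n (length σ) j) ,
  cong (λ i → map just σ ++ replicate i nothing) j≡
  where
  σ+j≡k : length σ + j ≡ k
  σ+j≡k = begin
    length σ + j
      ≡⟨ cong₂ _+_ (length-map just σ) (length-replicate j) ⟨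
    length (map just σ) + length (replicate j nothing)
      ≡⟨ length-++ (map just σ) ⟨
    length (map just σ ++ replicate j nothing)
      ≡⟨ len ⟩
    k ∎
    where open ≡-Reasoning
  j≡ : j ≡ k ∸ length σ
  j≡ = trans (sym (m+n∸m≡n (length σ) j)) (cong (_∸ length σ) σ+j≡k)

module Membership (g w : ℕ) where

  reachable : Vec Bool w → Layer g w → Maybe (Fin g) → Vec Bool w
  reachable S B c = tabulate λ q → anyᶠ w λ p →
    lookup S p ∧ lookup (lookup (lookup (Tr B) p) (code c)) q

  reachable-∋ : ∀ S B c q → lookup (reachable S B c) q ≡ true ⇔
                (∃ λ p → lookup S p ≡ true × InT B p c q)
  reachable-∋ S B c q = mk⇔ out into
    where
    out : lookup (reachable S B c) q ≡ true → _
    out h with to (anyᶠ-true w _) (trans (sym (lookup∘tabulate _ q)) h)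
    ... | p , h′ = p , to ∧-true h′
    into : _ → lookup (reachable S B c) q ≡ true
    into (p , Sp , t) = trans (lookup∘tabulate _ q) (from (anyᶠ-true w _) (p , from ∧-true (Sp , t)))

  -- nothing: no layer read yet; just (S , f): S is the set of states reachable through the layers
  -- read so far, and f says whether S meets the final states of the last of them.
  SimState : Set
  SimState = Maybe (Vec Bool w × Bool)

  advance : Vec Bool w → Layer g w → Maybe (Fin g) → SimState
  advance S B c = just (reachable S B c , anyᶠ w λ q → lookup (reachable S B c) q ∧ lookup (F B) q)

  simulation : Automaton (Maybe (Layer g w) × Maybe (Fin g))
  simulation = record
    { State     = SimState
    ; finite    = Finite-Maybe (Finite-× (Finite-Vec Finite-Bool w) Finite-Bool)
    ; initial   = nothing
    ; step      = δ
    ; accepting = λ { nothing → false ; (just (_ , f)) → f } }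
    where
    δ : SimState → Maybe (Layer g w) × Maybe (Fin g) → SimState
    δ nothing        (just B , c)  = advance (I B) B c
    δ (just (S , _)) (just B , c)  = advance S B c
    δ s              (nothing , _) = s

  acceptsFrom-advance : ∀ S B Bs c y → length y ≡ length Bs →
    AcceptsFrom simulation (advance S B c) (zip (map just Bs) y) ⇔
    (∃ λ p → lookup S p ≡ true × Path (B ∷ Bs) (c ∷ y) p)
  acceptsFrom-advance S B [] c [] _ = mk⇔ out into
    where
    out : AcceptsFrom simulation (advance S B c) [] → _
    out h with to (anyᶠ-true w _) h
    ... | q , h′ with to ∧-true h′
    ...   | reached , final with to (reachable-∋ S B c q) reached
    ...     | p , Sp , t = p , Sp , q , t , final
    into : _ → AcceptsFrom simulation (advance S B c) []
    into (p , Sp , q , t , final) =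
      from (anyᶠ-true w _) (q , from ∧-true (from (reachable-∋ S B c q) (p , Sp , t) , final))
  acceptsFrom-advance S B (B′ ∷ Bs) c (c′ ∷ y) len = mk⇔ out into
    where
    IH = acceptsFrom-advance (reachable S B c) B′ Bs c′ y (suc-injective len)
    out : _ → _
    out h with to IH h
    ... | q , reached , path with to (reachable-∋ S B c q) reached
    ...   | p , Sp , t = p , Sp , q , t , path
    into : _ → _
    into (p , Sp , q , t , path) = from IH (q , from (reachable-∋ S B c q) (p , Sp , t) , path)

  accepted-simulation : ∀ D y → length y ≡ length D →
                        Accepted simulation (zip (map just D) y) ⇔ Runs D y
  accepted-simulation []       y       _   = mk⇔ (λ ()) (λ ())
  accepted-simulation (B ∷ Bs) (c ∷ y) len = acceptsFrom-advance (I B) B Bs c y (suc-injective len)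

  member : Automaton (Maybe (Layer g w) × Maybe (Fin g))
  member = comap proj₂ (PaddedShape.shape (Fin g)) ∩ᴬ simulation

  accepted-member : ∀ D y → length y ≡ length D →
                    Accepted member (zip (map just D) y) ⇔ (∃ λ σ → y ≡ pad (length D) σ × InL D σ)
  accepted-member D y len = mk⇔ out into
    where
    open PaddedShape (Fin g) using (shape; accepted-shape)
    x = zip (map just D) y
    both = accepted-∩ᴬ (comap proj₂ shape) simulation x
    shaped = accepted-ignoring-track shape (map just D) y (trans (length-map just D) (sym len))
    out : Accepted member x → _
    out h with to both h
    ... | h₁ , h₂ with to (accepted-shape y) (to shaped h₁)
    ...   | σ , j , σ-nonempty , refl with padTo-of-length (length D) σ j len
    ...     | σ≤ , y≡ = σ , y≡ , from (InL⇔Runs D σ)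
                (σ-nonempty , σ≤ , subst (Runs D) y≡ (to (accepted-simulation D y len) h₂))
    into : _ → Accepted member x
    into (σ , y≡ , σ∈) with to (InL⇔Runs D σ) σ∈
    ... | σ-nonempty , _ , runs = from both
      ( from shaped (from (accepted-shape y) (σ , length D ∸ length σ , σ-nonempty , y≡))
      , from (accepted-simulation D y len) (subst (Runs D) (sym y≡) runs))

-- Membership in L(D₀)^{⊗a} and the inclusion L(D) ⊆ L(D₀)^{⊗a}

module _ {X : Set} (finX : Finite X) (ok : Maybe X → Bool) where

  lastLetter : Automaton (Maybe X)
  lastLetter = record
    { State     = Maybe X
    ; finite    = Finite-Maybe finX
    ; initial   = nothing
    ; step      = λ { q nothing → q ; _ (just c) → just c }
    ; accepting = ok }

  runFrom-padding : ∀ q j → runFrom lastLetter q (replicate j nothing) ≡ q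
  runFrom-padding q zero    = refl
  runFrom-padding q (suc j) = runFrom-padding q j

  runFrom-lastLetter : ∀ q c x j →
                       runFrom lastLetter q (map just (c ∷ x) ++ replicate j nothing) ≡ last (c ∷ x)
  runFrom-lastLetter q c []      j = runFrom-padding (just c) j
  runFrom-lastLetter q c (d ∷ x) j = runFrom-lastLetter (just c) d x j

  accepted-lastLetter : ∀ x j →
                        Accepted lastLetter (map just x ++ replicate j nothing) ⇔ ok (last x) ≡ true
  accepted-lastLetter []      j rewrite runFrom-padding nothing j        = mk⇔ id id
  accepted-lastLetter (c ∷ x) j rewrite runFrom-lastLetter nothing c x j = mk⇔ id id

map-head-zipWith-∷ : {X : Set} {a : ℕ} (xs : List X) (ys : List (Vec X a)) → length xs ≡ length ys →
                     map head (zipWith _∷ᵛ_ xs ys) ≡ xs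
map-head-zipWith-∷ []       []       _   = refl
map-head-zipWith-∷ (x ∷ xs) (y ∷ ys) len = cong (x ∷_) (map-head-zipWith-∷ xs ys (suc-injective len))

map-tail-zipWith-∷ : {X : Set} {a : ℕ} (xs : List X) (ys : List (Vec X a)) → length xs ≡ length ys →
                     map tail (zipWith _∷ᵛ_ xs ys) ≡ ys
map-tail-zipWith-∷ []       []       _   = refl
map-tail-zipWith-∷ (x ∷ xs) (y ∷ ys) len = cong (y ∷_) (map-tail-zipWith-∷ xs ys (suc-injective len))

zipWith-∷-head-tail : {X : Set} {a : ℕ} (z : List (Vec X (suc a))) →
                      zipWith _∷ᵛ_ (map head z) (map tail z) ≡ z
zipWith-∷-head-tail []             = refl
zipWith-∷-head-tail ((x ∷ᵛ v) ∷ z) = cong ((x ∷ᵛ v) ∷_) (zipWith-∷-head-tail z)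

replicate-[]ᵛ : {X : Set} (z : List (Vec X zero)) → z ≡ replicate (length z) []ᵛ
replicate-[]ᵛ []        = refl
replicate-[]ᵛ ([]ᵛ ∷ z) = cong ([]ᵛ ∷_) (replicate-[]ᵛ z)

InL-bounded-all : {g w a : ℕ} (D : List (Layer g w)) (us : Vec (List (Fin g)) a) → AllVec (InL D) us →
                  AllVec (λ u → length u ≤ length D) us
InL-bounded-all D []ᵛ       _          = tt
InL-bounded-all D (u ∷ᵛ us) (u∈ , us∈) = InL-bounded D u u∈ , InL-bounded-all D us us∈

module TensorMembership (s w : ℕ) where

  open Membership s w using (member; accepted-member)

  coordinatewise : (a : ℕ) → Automaton (Maybe (Layer s w) × Vec (Maybe (Fin s)) a)
  coordinatewise zero    = universal
  coordinatewise (suc a) = comap (map₂ head) member ∩ᴬ comap (map₂ tail) (coordinatewise a)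

  accepted-coordinatewise : ∀ a D (cols : List (Vec (Maybe (Fin s)) a)) → length cols ≡ length D →
    Accepted (coordinatewise a) (zip (map just D) cols) ⇔
    (∃ λ us → AllVec (InL D) us × cols ≡ tensorTo (length D) us)
  accepted-coordinatewise zero D cols len =
    mk⇔ (λ _ → []ᵛ , tt , trans (replicate-[]ᵛ cols) (cong (λ k → replicate k []ᵛ) len))
        (λ _ → refl)
  accepted-coordinatewise (suc a) D cols len = mk⇔ out into
    where
    k = length D
    t = map just D
    both = accepted-∩ᴬ (comap (map₂ head) member) (comap (map₂ tail) (coordinatewise a)) (zip t cols)
    heads = accepted-comap-map₂ head member t cols
    tails = accepted-comap-map₂ tail (coordinatewise a) t cols
    headsIn = accepted-member D (map head cols) (trans (length-map head cols) len)
    tailsIn = accepted-coordinatewise a D (map tail cols) (trans (length-map tail cols) len)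
    out : Accepted (coordinatewise (suc a)) (zip t cols) → _
    out h with to both h
    ... | h₁ , h₂ with to headsIn (to heads h₁) | to tailsIn (to tails h₂)
    ...   | σ , heads≡ , σ∈ | us , us∈ , tails≡ = σ ∷ᵛ us , (σ∈ , us∈) ,
            trans (sym (zipWith-∷-head-tail cols)) (cong₂ (zipWith _∷ᵛ_) heads≡ tails≡)
    into : _ → Accepted (coordinatewise (suc a)) (zip t cols)
    into (σ ∷ᵛ us , (σ∈ , us∈) , cols≡) = from both
      ( from heads (from headsIn
          (σ , trans (cong (map head) cols≡) (map-head-zipWith-∷ _ _ same-length) , σ∈))
      , from tails (from tailsIn
          (us , us∈ , trans (cong (map tail) cols≡) (map-tail-zipWith-∷ _ _ same-length))))
      where
      same-length : length (padTo k σ) ≡ length (tensorTo k us)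
      same-length = trans (length-padTo k σ (InL-bounded D σ σ∈))
                          (sym (length-tensorTo k us (InL-bounded-all D us us∈)))

  module _ (a : ℕ) where

    hash : Vec (Maybe (Fin s)) a
    hash = allHash a

    _≟ᶜ_ : DecidableEquality (Vec (Maybe (Fin s)) a)
    _≟ᶜ_ = ≡-dec (≡-decᴹ _≟_)

    -- The padding symbol # of Σ^{⊗a} stands for the all-# column.
    decodeColumn : Maybe (Fin (tensorSize s a)) → Vec (Maybe (Fin s)) a
    decodeColumn nothing  = hash
    decodeColumn (just c) = untuple a c

    map-decodeColumn : ∀ x j → map decodeColumn (map just x ++ replicate j nothing)
                               ≡ map (untuple a) x ++ replicate j hash
    map-decodeColumn x j
      rewrite map-++ decodeColumn (map just x) (replicate j nothing) | map-replicate decodeColumn j nothing =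
      cong (_++ replicate j hash) (sym (map-∘ x))

    notHash : Maybe (Fin (tensorSize s a)) → Bool
    notHash nothing  = true
    notHash (just c) = not (does (untuple a c ≟ᶜ hash))

    notHash-true : ∀ m → notHash m ≡ true ⇔ mapᴹ (untuple a) m ≢ just hash
    notHash-true nothing  = mk⇔ (λ _ ()) (λ _ → refl)
    notHash-true (just c) with untuple a c ≟ᶜ hash
    ... | yes c≡ = mk⇔ (λ ()) (λ c≢ → ⊥-elim (c≢ (cong just c≡)))
    ... | no  c≢ = mk⇔ (λ _ eq → c≢ (just-injective eq)) (λ _ → refl)

    notHash-last : ∀ x → notHash (last x) ≡ true ⇔ last (map (untuple a) x) ≢ just hash
    notHash-last x rewrite last-map (untuple a) x = notHash-true (last x)

    lastCheck : Automaton (Maybe (Fin (tensorSize s a)))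
    lastCheck = lastLetter (Finite-Fin (tensorSize s a)) notHash

    inTensor : Automaton (Maybe (Layer s w) × Maybe (Fin (tensorSize s a)))
    inTensor = comap (map₂ decodeColumn) (coordinatewise a) ∩ᴬ comap proj₂ lastCheck

    -- tensor us never ends in the all-# column, so it is recovered from its padding to length |D|.
    accepted-inTensor : ∀ D x → length x ≤ length D →
                        Accepted inTensor (zip (map just D) (pad (length D) x)) ⇔ InTensorL a D x
    accepted-inTensor D x x≤ = mk⇔ out into
      where
      k = length D
      t = map just D
      y = pad k x
      padding = replicate (k ∸ length x) hash
      y-length : length y ≡ k
      y-length = length-padTo k x x≤
      both = accepted-∩ᴬ (comap (map₂ decodeColumn) (coordinatewise a)) (comap proj₂ lastCheck) (zip t y)
      columns = accepted-comap-map₂ decodeColumn (coordinatewise a) t y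
      columnsIn = accepted-coordinatewise a D (map decodeColumn y) (trans (length-map decodeColumn y) y-length)
      lastNotHash : Accepted (comap proj₂ lastCheck) (zip t y) ⇔ last (map (untuple a) x) ≢ just hash
      lastNotHash = notHash-last x ⇔-∘ (accepted-lastLetter (Finite-Fin _) notHash x (k ∸ length x)
                    ⇔-∘ accepted-ignoring-track lastCheck t y (trans (length-map just D) (sym y-length)))
      open Trailing _≟ᶜ_ hash using (++-replicate-cancel)
      out : Accepted inTensor (zip t y) → InTensorL a D x
      out h with to both h
      ... | h₁ , h₂ with to columnsIn (to columns h₁)
      ...   | us , us∈ , cols≡ = us , us∈ , ++-replicate-cancel (tensor us) (map (untuple a) x) _ _
              (trans (padWith-tensor k us (InL-bounded-all D us us∈))
                     (trans (sym cols≡) (map-decodeColumn x _)))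
              (last-tensor us) (to lastNotHash h₂)
      into : InTensorL a D x → Accepted inTensor (zip t y)
      into (us , us∈ , tensor≡) = from both
        ( from columns (from columnsIn (us , us∈ , columns≡))
        , from lastNotHash (subst (λ z → last z ≢ just hash) tensor≡ (last-tensor us)))
        where
        tensor-length : length (tensor us) ≡ length x
        tensor-length = trans (cong length tensor≡) (length-map (untuple a) x)
        columns≡ : map decodeColumn y ≡ tensorTo k us
        columns≡ = begin
          map decodeColumn y            ≡⟨ map-decodeColumn x _ ⟩
          map (untuple a) x ++ padding  ≡⟨ cong (_++ padding) tensor≡ ⟨
          tensor us ++ padding
            ≡⟨ cong (λ i → tensor us ++ replicate (k ∸ i) hash) tensor-length ⟨
          padWith hash k (tensor us)    ≡⟨ padWith-tensor k us (InL-bounded-all D us us∈) ⟩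
          tensorTo k us                 ∎
          where open ≡-Reasoning

module Inclusion (s w a : ℕ) where

  private
    TS = tensorSize s a

  open Membership TS w using (member; accepted-member)
  open TensorMembership s w using (inTensor; accepted-inTensor)

  Included : List (Layer s w) → List (Layer TS w) → Set
  Included D₀ D = ∀ x → InL D x → InTensorL a D₀ x

  counterexample : Automaton ((Maybe (Layer s w) × Maybe (Layer TS w)) × Maybe (Fin TS))
  counterexample = comap (map₁ proj₂) member ∩ᴬ comap (map₁ proj₁) (complement (inTensor a))

  included : Automaton (Maybe (Layer s w) × Maybe (Layer TS w))
  included = complement (Projection.project (Finite-Maybe (Finite-Fin TS)) counterexample)

  module _ (D₀ : List (Layer s w)) (D : List (Layer TS w)) (len : length D ≡ length D₀) where

    private
      k = length D₀
      open Projection (Finite-Maybe (Finite-Fin TS)) counterexample using (project; accepted-project)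
      tracks = zip (map just D₀) (map just D)
      tracks-length : length (map just D₀) ≡ length (map just D)
      tracks-length = trans (length-map just D₀) (trans (sym len) (sym (length-map just D)))

    accepted-counterexample : ∀ ys → Accepted counterexample (zip tracks ys) ⇔
      (Accepted member (zip (map just D) ys) × ¬ Accepted (inTensor a) (zip (map just D₀) ys))
    accepted-counterexample ys =
      (inD ×-⇔ (accepted-complement (inTensor a) (zip (map just D₀) ys) ⇔-∘ outside))
      ⇔-∘ accepted-∩ᴬ (comap (map₁ proj₂) member) (comap (map₁ proj₁) (complement (inTensor a)))
                      (zip tracks ys)
      where
      inD = accepted-comap (map₁ proj₂) member (trans (map-map₁-zip proj₂ tracks ys)
              (cong (λ t → zip t ys) (map-proj₂-zip (map just D₀) (map just D) tracks-length)))
      outside = accepted-comap (map₁ proj₁) (complement (inTensor a))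
                  (trans (map-map₁-zip proj₁ tracks ys)
                         (cong (λ t → zip t ys) (map-proj₁-zip (map just D₀) (map just D) tracks-length)))

    accepted-included : Accepted included tracks ⇔ Included D₀ D
    accepted-included = mk⇔ out into
      where
      tracks-length′ : length tracks ≡ k
      tracks-length′ = length-zipWith-≡ _,_ (map just D₀) (map just D)
                         (length-map just D₀) (trans (length-map just D) len)
      bounded : ∀ {x} → InL D x → length x ≤ k
      bounded {x} x∈ = subst (length x ≤_) len (InL-bounded D x x∈)
      out : Accepted included tracks → Included D₀ D
      out h x x∈ with accepted? (inTensor a) (zip (map just D₀) (pad k x))
      ... | yes inside = to (accepted-inTensor a D₀ x (bounded x∈)) inside
      ... | no outside = ⊥-elim (to (accepted-complement project tracks) h (from (accepted-project tracks)
              ( pad k x , trans (length-padTo k x (bounded x∈)) (sym tracks-length′)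
              , from (accepted-counterexample (pad k x)) (inD , outside))))
        where
        inD = from (accepted-member D (pad k x) (trans (length-padTo k x (bounded x∈)) (sym len)))
                   (x , cong (λ i → pad i x) (sym len) , x∈)
      into : Included D₀ D → Accepted included tracks
      into incl = from (accepted-complement project tracks) λ h → refute (to (accepted-project tracks) h)
        where
        refute : (∃ λ ys → length ys ≡ length tracks × Accepted counterexample (zip tracks ys)) → ⊥
        refute (ys , ys-length , bad) with to (accepted-counterexample ys) bad
        ... | inD , outside
            with to (accepted-member D ys (trans ys-length (trans tracks-length′ (sym len)))) inD
        ...   | σ , ys≡ , σ∈ = outside (subst (λ z → Accepted (inTensor a) (zip (map just D₀) z))
                  (sym (trans ys≡ (cong (λ i → pad i σ) len)))
                  (from (accepted-inTensor a D₀ σ (bounded σ∈)) (incl σ σ∈)))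

-- The automaton for 𝓡(Σ,w,τ,n)

RecognisesPadded : {T X : Set} → Automaton (T × Maybe X) → List T → ℕ → (List X → Set) → Set
RecognisesPadded A t k P =
  ∀ y → length y ≡ k → Accepted A (zip t y) ⇔ (∃ λ u → y ≡ padTo k u × P u)

RecognisesConv : {T : Set} (As : List Set) → Automaton (T × Col As) → List T → ℕ →
                 (Strs As → Set) → Set
RecognisesConv As B t k Q =
  ∀ z → length z ≡ k → Accepted B (zip t z) ⇔ (∃ λ us → z ≡ convTo As k us × Q us)

universal-recognisesConv : {T : Set} (t : List T) (k : ℕ) → RecognisesConv [] universal t k (λ _ → ⊤)
universal-recognisesConv t k z len =
  mk⇔ (λ _ → tt , trans (replicate-tt z) (cong (λ i → replicate i tt) len) , tt) (λ _ → refl)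
  where
  replicate-tt : (z : List ⊤) → z ≡ replicate (length z) tt
  replicate-tt []       = refl
  replicate-tt (tt ∷ z) = cong (tt ∷_) (replicate-tt z)

⊗ᵗ-recognisesConv : {T X : Set} {As : List Set} {P : List X → Set} {Q : Strs As → Set}
  (A : Automaton (T × Maybe X)) (B : Automaton (T × Col As)) (t : List T) (k : ℕ) →
  RecognisesPadded A t k P → (∀ {u} → P u → length u ≤ k) →
  RecognisesConv As B t k Q → (∀ {us} → Q us → BoundedBy As k us) →
  RecognisesConv (X ∷ As) (A ⊗ᵗ B) t k (λ (u , us) → P u × Q us)
⊗ᵗ-recognisesConv {As = As} A B t k recA boundA recB boundB z len = mk⇔ out into
  where
  both = accepted-⊗ᵗ A B t z
  firsts = recA (map proj₁ z) (trans (length-map proj₁ z) len)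
  rests = recB (map proj₂ z) (trans (length-map proj₂ z) len)
  out : Accepted (A ⊗ᵗ B) (zip t z) → _
  out h with to both h
  ... | h₁ , h₂ with to firsts h₁ | to rests h₂
  ...   | u , firsts≡ , Pu | us , rests≡ , Qus =
          (u , us) , trans (sym (zip-map-proj₁-map-proj₂ z)) (cong₂ zip firsts≡ rests≡) , Pu , Qus
  into : _ → Accepted (A ⊗ᵗ B) (zip t z)
  into ((u , us) , z≡ , Pu , Qus) = from both
    ( from firsts (u , trans (cong (map proj₁) z≡) (map-proj₁-zip _ _ same-length) , Pu)
    , from rests (us , trans (cong (map proj₂) z≡) (map-proj₂-zip _ _ same-length) , Qus))
    where
    same-length : length (padTo k u) ≡ length (convTo As k us)
    same-length = trans (length-padTo k u (boundA Pu)) (sym (length-convTo As k us (boundB Qus)))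

module Structural (s w : ℕ) where

  Others : List ℕ → ℕ → List Set
  Others τ n = LayerAlphs s w τ ++ replicate n (Fin s)

  StructuralLayer : (a : ℕ) → List (Layer s w) → List (Layer (tensorSize s a) w) → Set
  StructuralLayer a D₀ D = IsODD D × length D ≡ length D₀ × Inclusion.Included s w a D₀ D

  layerCheck : (a : ℕ) → Automaton (Maybe (Layer s w) × Maybe (Layer (tensorSize s a) w))
  layerCheck a = comap proj₂ (ODDRecognizer.recognizer (tensorSize s a) w) ∩ᴬ Inclusion.included s w a

  layerCheck-recognises : ∀ a D₀ →
    RecognisesPadded (layerCheck a) (map just D₀) (length D₀) (StructuralLayer a D₀)
  layerCheck-recognises a D₀ y len = mk⇔ (out y len) (into y len)
    where
    open ODDRecognizer (tensorSize s a) w using (recognizer; accepted-recognizer)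
    open Inclusion s w a using (included; accepted-included)
    k = length D₀
    Column = Maybe (Layer (tensorSize s a) w)
    both : ∀ y → Accepted (layerCheck a) (zip (map just D₀) y) ⇔ _
    both y = accepted-∩ᴬ (comap proj₂ recognizer) included (zip (map just D₀) y)
    odd : ∀ y → length y ≡ k →
          Accepted (comap proj₂ recognizer) (zip (map just D₀) y) ⇔ Accepted recognizer y
    odd y len = accepted-ignoring-track recognizer (map just D₀) y (trans (length-map just D₀) (sym len))
    out : ∀ (y : List Column) → length y ≡ k → Accepted (layerCheck a) (zip (map just D₀) y) →
          ∃ λ D → y ≡ padTo k D × StructuralLayer a D₀ D
    out y len h with to (both y) h
    ... | h₁ , h₂ with to (accepted-recognizer y) (to (odd y len) h₁)
    ...   | D , refl , D-odd =
            D , sym (padTo-full D D-length) , D-odd , D-length , to (accepted-included D₀ D D-length) h₂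
      where
      D-length : length D ≡ k
      D-length = trans (sym (length-map just D)) len
    into : ∀ (y : List Column) → length y ≡ k →
           (∃ λ D → y ≡ padTo k D × StructuralLayer a D₀ D) → Accepted (layerCheck a) (zip (map just D₀) y)
    into y len (D , y≡ , D-odd , D-length , incl) rewrite trans y≡ (padTo-full D D-length) =
      from (both (map just D))
        ( from (odd (map just D) (trans (length-map just D) D-length))
               (from (accepted-recognizer (map just D)) (D , refl , D-odd))
        , from (accepted-included D₀ D D-length) incl)

  Conforms : List (Layer s w) → (τ : List ℕ) (n : ℕ) → Strs (Others τ n) → Set
  Conforms D₀ []      zero    _        = ⊤
  Conforms D₀ []      (suc n) (v , vs) = InL D₀ v × Conforms D₀ [] n vs
  Conforms D₀ (a ∷ τ) n       (D , Ds) = StructuralLayer a D₀ D × Conforms D₀ τ n Ds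

  Conforms-bounded : ∀ D₀ τ n {t} → Conforms D₀ τ n t → BoundedBy (Others τ n) (length D₀) t
  Conforms-bounded D₀ []      zero    _                    = tt
  Conforms-bounded D₀ []      (suc n) {v , _} (v∈ , vs)    =
    InL-bounded D₀ v v∈ , Conforms-bounded D₀ [] n vs
  Conforms-bounded D₀ (a ∷ τ) n       ((_ , len , _) , Ds) =
    ≤-reflexive len , Conforms-bounded D₀ τ n Ds

  split : ∀ τ n → Strs (Others τ n) → Strs (LayerAlphs s w τ) × Strs (replicate n (Fin s))
  split τ n = splitStrs (LayerAlphs s w τ) (replicate n (Fin s))

  Conforms⇔ : ∀ D₀ τ n rest → Conforms D₀ τ n rest ⇔
    (NonEmptyAll (Others τ n) rest × StructRest D₀ τ (proj₁ (split τ n rest))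
                                   × AllInL D₀ n (proj₂ (split τ n rest)))
  Conforms⇔ D₀ []      zero    _        = mk⇔ (λ _ → tt , tt , tt) (λ _ → tt)
  Conforms⇔ D₀ []      (suc n) (v , vs) = mk⇔
    (λ (v∈ , c) → let ne , _ , vs∈ = to (Conforms⇔ D₀ [] n vs) c in
       (InL-nonempty D₀ v v∈ , ne) , tt , v∈ , vs∈)
    (λ ((_ , ne) , _ , v∈ , vs∈) → v∈ , from (Conforms⇔ D₀ [] n vs) (ne , tt , vs∈))
  Conforms⇔ D₀ (a ∷ τ) n       (D , Ds) = mk⇔
    (λ ((D-odd , D-length , incl) , c) → let ne , sr , vs∈ = to (Conforms⇔ D₀ τ n Ds) c in
       (IsODD-nonempty D D-odd , ne) , (D-odd , D-length , incl , sr) , vs∈)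
    (λ ((_ , ne) , (D-odd , D-length , incl , sr) , vs∈) →
       (D-odd , D-length , incl) , from (Conforms⇔ D₀ τ n Ds) (ne , sr , vs∈))

  others : (τ : List ℕ) (n : ℕ) → Automaton (Maybe (Layer s w) × Col (Others τ n))
  others []      zero    = universal
  others []      (suc n) = Membership.member s w ⊗ᵗ others [] n
  others (a ∷ τ) n       = layerCheck a ⊗ᵗ others τ n

  others-recognises : ∀ τ n D₀ →
    RecognisesConv (Others τ n) (others τ n) (map just D₀) (length D₀) (Conforms D₀ τ n)
  others-recognises []      zero    D₀ = universal-recognisesConv (map just D₀) (length D₀)
  others-recognises []      (suc n) D₀ =
    ⊗ᵗ-recognisesConv (Membership.member s w) (others [] n) (map just D₀) (length D₀)
      (Membership.accepted-member s w D₀) (InL-bounded D₀ _)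
      (others-recognises [] n D₀) (Conforms-bounded D₀ [] n)
  others-recognises (a ∷ τ) n       D₀ =
    ⊗ᵗ-recognisesConv (layerCheck a) (others τ n) (map just D₀) (length D₀)
      (layerCheck-recognises a D₀) (λ (_ , len , _) → ≤-reflexive len)
      (others-recognises τ n D₀) (Conforms-bounded D₀ τ n)

  relation : (τ : List ℕ) (n : ℕ) → Automaton (Col (CoordsR s w τ n))
  relation τ n = comap proj₁ (ODDRecognizer.recognizer s w) ∩ᴬ others τ n

  accepted-relation : ∀ τ n x → Accepted (relation τ n) x ⇔
    (∃ λ t → NonEmptyAll (CoordsR s w τ n) t × RelR s w τ n t × conv (CoordsR s w τ n) t ≡ x)
  accepted-relation τ n x = mk⇔ out into
    where
    open ODDRecognizer s w using (recognizer; accepted-recognizer)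
    Bs = Others τ n
    both : ∀ x → Accepted (relation τ n) x ⇔ _
    both x = accepted-∩ᴬ (comap proj₁ recognizer) (others τ n) x
    out : Accepted (relation τ n) x → _
    out h with to (both x) h
    ... | h₁ , h₂
        with to (accepted-recognizer (map proj₁ x)) (to (accepted-comap proj₁ recognizer {x} refl) h₁)
    ...   | D₀ , firsts≡ , D₀-odd
          with to (others-recognises τ n D₀ (map proj₂ x) rests-length)
                  (subst (Accepted (others τ n)) x≡ h₂)
      where
      x≡ : x ≡ zip (map just D₀) (map proj₂ x)
      x≡ = trans (sym (zip-map-proj₁-map-proj₂ x)) (cong (λ f → zip f (map proj₂ x)) firsts≡)
      rests-length : length (map proj₂ x) ≡ length D₀
      rests-length = trans (length-map proj₂ x)
        (trans (sym (length-map proj₁ x)) (trans (cong length firsts≡) (length-map just D₀)))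
    ...     | rest , rest≡ , conforms with to (Conforms⇔ D₀ τ n rest) conforms
    ...       | ne , sr , vs∈ =
                (D₀ , rest) , (IsODD-nonempty D₀ D₀-odd , ne) , ((D₀-odd , sr) , vs∈) , conv≡
      where
      conv≡ : conv (CoordsR s w τ n) (D₀ , rest) ≡ x
      conv≡ = begin
        conv (CoordsR s w τ n) (D₀ , rest)
          ≡⟨ conv-longest Bs D₀ rest (Conforms-bounded D₀ τ n conforms) ⟩
        zip (map just D₀) (convTo Bs (length D₀) rest)  ≡⟨ cong (zip (map just D₀)) rest≡ ⟨
        zip (map just D₀) (map proj₂ x)                 ≡⟨ cong (λ f → zip f (map proj₂ x)) firsts≡ ⟨
        zip (map proj₁ x) (map proj₂ x)                 ≡⟨ zip-map-proj₁-map-proj₂ x ⟩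
        x                                               ∎
        where open ≡-Reasoning
    into : _ → Accepted (relation τ n) x
    into ((D₀ , rest) , (_ , ne) , ((D₀-odd , sr) , vs∈) , conv≡) =
      subst (Accepted (relation τ n)) x≡ (from (both (zip (map just D₀) columns))
        ( from (accepted-comap proj₁ recognizer (map-proj₁-zip (map just D₀) columns same-length))
               (from (accepted-recognizer (map just D₀)) (D₀ , refl , D₀-odd))
        , from (others-recognises τ n D₀ columns columns-length) (rest , refl , conforms)))
      where
      conforms = from (Conforms⇔ D₀ τ n rest) (ne , sr , vs∈)
      columns = convTo Bs (length D₀) rest
      columns-length = length-convTo Bs (length D₀) rest (Conforms-bounded D₀ τ n conforms)
      same-length = trans (length-map just D₀) (sym columns-length)
      x≡ : zip (map just D₀) columns ≡ x
      x≡ = trans (sym (conv-longest Bs D₀ rest (Conforms-bounded D₀ τ n conforms))) conv≡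

lemma3 : (s w : ℕ) → 1 ≤ w → (τ : List ℕ) → All (1 ≤_) τ → (n : ℕ)
         → Regular (CoordsR s w τ n) (RelR s w τ n)
lemma3 s w _ τ _ n =
  toDFA (relation τ n) , λ x → accepted-relation τ n x ⇔-∘ accepts-toDFA (relation τ n) x
  where open Structural s w
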